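{- Let $\mathcal{L}$ be the category whose objects are natural numbers and whose morphisms $m\to n$ are the total injective increasing functions $[m]\to[n]$. Let $P\in\hat{\mathcal{L}}$ be a presheaf which is a finite colimit of representable presheaves and which preserves finite limits, i.e. for every finite diagram $D$ in $\mathcal{L}$ admitting a colimit in $\mathcal{L}$, the functor $P:\mathcal{L}^{op}\to\mathrm{Set}$ sends the colimiting cocone of $D$ to a limiting cone in $\mathrm{Set}$. Then: (1) the underlying graph of $P$ is finite; (2) for each non-empty path from a vertex $x$ to a vertex $y$ in the underlying graph there exists exactly one edge $x\to y$ (in particular there is at most one edge between two vertices); (3) for every $n\ge1$, the map sending $\alpha\in P(n+1)$ to $(P(e^n_0)(\alpha),\dots,P(e^n_{n-1})(\alpha))$ is a bijection from $P(n+1)$ onto the set of paths of length $n$ in the underlying graph of $P$, and $P(0)$ has exactly one element.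
   Context: For $n\in\mathbb{N}$ write $[n]=\{0,\dots,n-1\}$. $\hat{\mathcal{L}}$ denotes the category of functors $\mathcal{L}^{op}\to\mathrm{Set}$ and natural transformations; a representable presheaf is one of the form $\mathcal{L}(-,n)$. For $n\in\mathbb{N}$ and $i\in[n+1]$, $s^n_i:n\to n+1$ is the increasing injection whose image is $[n+1]\setminus\{i\}$. For $n\ge1$ and $j\in[n]$, $e^n_j:2\to n+1$ is the morphism $0\mapsto j$, $1\mapsto j+1$. The underlying graph of $P$ has vertex set $P(1)$, edge set $P(2)$, source of an edge $e$ given by $P(s^1_1)(e)$ and target by $P(s^1_0)(e)$. A path of length $k\ge1$ is a sequence of $k$ edges each of whose target is the source of the next. -}

module Defs where

open import Level using (Level)
open import Data.Nat as ℕ using (ℕ; zero; suc)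
import Data.Nat.Properties as ℕP
open import Data.Fin as Fin using (Fin; zero; suc; inject₁; punchIn; toℕ)
import Data.Fin.Properties as FinP
open import Data.Vec using (Vec; []; _∷_; lookup; map; tabulate; allFin; head; last)
open import Data.Vec.Properties using (lookup-map; lookup∘tabulate; map-∘; map-cong; tabulate∘lookup; tabulate-∘)
open import Data.Product using (Σ; _×_; _,_)
open import Function using (id; _∘′_)
open import Relation.Binary.PropositionalEquality

-- Objects: natural numbers n, standing for [n] = {0,…,n-1} = Fin n.
-- A morphism m → n is a total injective increasing function [m] → [n],
-- recorded by its table of values (a vector of length m in Fin n), together
-- with the (irrelevant) proof that it is strictly increasing
-- (strictly increasing = injective and increasing for maps of finite
-- linear orders).

StrictlyIncreasing : ∀ {m n} → Vec (Fin n) m → Set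
StrictlyIncreasing {m} v = (i j : Fin m) → i Fin.< j → lookup v i Fin.< lookup v j

record Hom (m n : ℕ) : Set where
  constructor hom
  field
    table : Vec (Fin n) m
    .increasing : StrictlyIncreasing table
open Hom public

app : ∀ {m n} → Hom m n → Fin m → Fin n
app f i = lookup (table f) i

idL : ∀ n → Hom n n
idL n = hom (allFin n) λ i j i<j →
  subst₂ Fin._<_ (sym (lookup∘tabulate id i)) (sym (lookup∘tabulate id j)) i<j

infixr 9 _∘L_
_∘L_ : ∀ {l m n} → Hom m n → Hom l m → Hom l n
hom g pg ∘L hom f pf = hom (map (lookup g) f) λ i j i<j →
  subst₂ Fin._<_ (sym (lookup-map i (lookup g) f)) (sym (lookup-map j (lookup g) f))
         (pg _ _ (pf i j i<j))

-- s^n_i : n → n+1, the increasing injection with image [n+1] ∖ {i}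
s : ∀ n → Fin (suc n) → Hom n (suc n)
s n i = hom (tabulate (punchIn i)) λ j k j<k →
  subst₂ Fin._<_ (sym (lookup∘tabulate (punchIn i) j)) (sym (lookup∘tabulate (punchIn i) k))
    (FinP.≤∧≢⇒< (FinP.punchIn-mono-≤ i j k (ℕP.<⇒≤ j<k))
                (λ eq → FinP.<⇒≢ j<k (FinP.punchIn-injective i j k eq)))

e : ∀ n → Fin n → Hom 2 (suc n)
e n j = hom (inject₁ j ∷ suc j ∷ []) incr
  where
  incr : StrictlyIncreasing (inject₁ j ∷ suc j ∷ [])
  incr zero zero ()
  incr zero (suc zero) _ = FinP.≤̄⇒inject₁< ℕP.≤-refl
  incr (suc zero) zero ()
  incr (suc zero) (suc zero) (ℕ.s≤s ())

Hom-≡ : ∀ {m n} {f g : Hom m n} → table f ≡ table g → f ≡ g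
Hom-≡ {f = hom t _} {g = hom .t _} refl = refl

∘L-identityʳ : ∀ {m n} (f : Hom m n) → f ∘L idL m ≡ f
∘L-identityʳ (hom f _) = Hom-≡ (trans (sym (tabulate-∘ (lookup f) id)) (tabulate∘lookup f))

∘L-assoc : ∀ {k l m n} (h : Hom m n) (g : Hom l m) (f : Hom k l) →
           (h ∘L g) ∘L f ≡ h ∘L (g ∘L f)
∘L-assoc (hom h _) (hom g _) (hom f _) = Hom-≡ (begin
  map (lookup (map (lookup h) g)) f  ≡⟨ map-cong (λ i → lookup-map i (lookup h) g) f ⟩
  map (lookup h ∘′ lookup g) f       ≡⟨ map-∘ (lookup h) (lookup g) f ⟩
  map (lookup h) (map (lookup g) f)  ∎)
  where open ≡-Reasoning

record Presheaf : Set₁ where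
  field
    F₀ : ℕ → Set
    F₁ : ∀ {m n} → Hom m n → F₀ n → F₀ m
    F-id : ∀ {n} (x : F₀ n) → F₁ (idL n) x ≡ x
    F-∘ : ∀ {l m n} (g : Hom m n) (f : Hom l m) (x : F₀ n) →
          F₁ (g ∘L f) x ≡ F₁ f (F₁ g x)
open Presheaf public

record NatTrans (F G : Presheaf) : Set where
  field
    η : ∀ n → F₀ F n → F₀ G n
    natural : ∀ {m n} (f : Hom m n) (x : F₀ F n) → η m (F₁ F f x) ≡ F₁ G f (η n x)
open NatTrans public

よ : ℕ → Presheaf
よ k = record
  { F₀ = λ n → Hom n k
  ; F₁ = λ f h → h ∘L f
  ; F-id = ∘L-identityʳ
  ; F-∘ = λ g f h → sym (∘L-assoc h g f)
  }

record FinCat : Set where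
  field
    nOb : ℕ
    nHom : Fin nOb → Fin nOb → ℕ
    idJ : ∀ i → Fin (nHom i i)
    compJ : ∀ {i j k} → Fin (nHom j k) → Fin (nHom i j) → Fin (nHom i k)
    idJˡ : ∀ {i j} (f : Fin (nHom i j)) → compJ (idJ j) f ≡ f
    idJʳ : ∀ {i j} (f : Fin (nHom i j)) → compJ f (idJ i) ≡ f
    assocJ : ∀ {i j k l} (h : Fin (nHom k l)) (g : Fin (nHom j k)) (f : Fin (nHom i j)) →
             compJ (compJ h g) f ≡ compJ h (compJ g f)
open FinCat public

record Diagram (J : FinCat) : Set where
  field
    ob : Fin (nOb J) → ℕ
    mor : ∀ {i j} → Fin (nHom J i j) → Hom (ob i) (ob j)
    mor-id : ∀ i → mor (idJ J i) ≡ idL (ob i)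
    mor-∘ : ∀ {i j k} (g : Fin (nHom J j k)) (f : Fin (nHom J i j)) →
            mor (compJ J g f) ≡ mor g ∘L mor f
open Diagram public

IsCoconeL : ∀ {J} (D : Diagram J) (c : ℕ) (λc : ∀ i → Hom (ob D i) c) → Set
IsCoconeL {J} D c λc = ∀ {i j} (f : Fin (nHom J i j)) → λc j ∘L mor D f ≡ λc i

IsColimitL : ∀ {J} (D : Diagram J) (c : ℕ) (λc : ∀ i → Hom (ob D i) c) → Set
IsColimitL {J} D c λc =
  IsCoconeL D c λc ×
  ((c′ : ℕ) (μ : ∀ i → Hom (ob D i) c′) → IsCoconeL D c′ μ →
    Σ (Hom c c′) λ u → ((i : Fin (nOb J)) → u ∘L λc i ≡ μ i) ×
      ((u′ : Hom c c′) → ((i : Fin (nOb J)) → u′ ∘L λc i ≡ μ i) → u′ ≡ u))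

IsLimitConeSet : (P : Presheaf) {J : FinCat} (D : Diagram J) (c : ℕ)
                 (λc : ∀ i → Hom (ob D i) c) → Set₁
IsLimitConeSet P {J} D c λc =
  (X : Set) (g : ∀ i → X → F₀ P (ob D i)) →
  (∀ {i j} (f : Fin (nHom J i j)) (x : X) → F₁ P (mor D f) (g j x) ≡ g i x) →
  Σ (X → F₀ P c) λ u → (∀ i x → F₁ P (λc i) (u x) ≡ g i x) ×
    ((u′ : X → F₀ P c) → (∀ i x → F₁ P (λc i) (u′ x) ≡ g i x) → ∀ x → u′ x ≡ u x)

PreservesFiniteLimits : Presheaf → Set₁
PreservesFiniteLimits P =
  (J : FinCat) (D : Diagram J) (c : ℕ) (λc : ∀ i → Hom (ob D i) c) →
  IsColimitL D c λc → IsLimitConeSet P D c λc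

IsCoconePsh : ∀ {J} (D : Diagram J) (Q : Presheaf) (σ : ∀ i → NatTrans (よ (ob D i)) Q) → Set
IsCoconePsh {J} D Q σ =
  ∀ {i j} (f : Fin (nHom J i j)) n (h : Hom n (ob D i)) → η (σ j) n (mor D f ∘L h) ≡ η (σ i) n h

IsColimitPsh : ∀ {J} (D : Diagram J) (P : Presheaf) (σ : ∀ i → NatTrans (よ (ob D i)) P) → Set₁
IsColimitPsh {J} D P σ =
  IsCoconePsh D P σ ×
  ((Q : Presheaf) (τ : ∀ i → NatTrans (よ (ob D i)) Q) → IsCoconePsh D Q τ →
    Σ (NatTrans P Q) λ u → (∀ i n h → η u n (η (σ i) n h) ≡ η (τ i) n h) ×
      ((u′ : NatTrans P Q) → (∀ i n h → η u′ n (η (σ i) n h) ≡ η (τ i) n h) →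
        ∀ n x → η u′ n x ≡ η u n x))

FiniteColimitOfRepresentables : Presheaf → Set₁
FiniteColimitOfRepresentables P =
  Σ FinCat λ J → Σ (Diagram J) λ D → Σ (∀ i → NatTrans (よ (ob D i)) P) λ σ →
    IsColimitPsh D P σ

Vertex : Presheaf → Set
Vertex P = F₀ P 1

Edge : Presheaf → Set
Edge P = F₀ P 2

src : (P : Presheaf) → Edge P → Vertex P
src P = F₁ P (s 1 (suc zero))

tgt : (P : Presheaf) → Edge P → Vertex P
tgt P = F₁ P (s 1 zero)

IsPath : (P : Presheaf) {k : ℕ} → Vec (Edge P) k → Set
IsPath P {k} v = (i j : Fin k) → toℕ j ≡ suc (toℕ i) → tgt P (lookup v i) ≡ src P (lookup v j)

edgesOf : (P : Presheaf) (n : ℕ) → F₀ P (suc n) → Vec (Edge P) n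
edgesOf P n α = tabulate λ j → F₁ P (e n j) α

module Submission where

-- Apart from finiteness, everything follows by applying limit preservation to
-- three colimits in 𝓛, each indexed by a finite category whose non-identity
-- arrows never compose (module SparseShape builds such categories and
-- translates limit preservation into gluing of compatible families):
--   * the empty diagram, with colimit 0: P(0) is a singleton;
--   * two copies of 2 glued along both endpoints, with colimit 2: an edge is
--     determined by its source and its target;
--   * 2 and n+1 glued along a vertex, with colimit n+2 (an edge followed by a
--     path): by induction on n, α ↦ edgesOf α is a bijection from P(n+1) onto
--     the paths of length n (module LimitPreservation).
-- The edge required in (2) is the outer face 0 → n of the element of P(n+1)
-- realising the given path.  Finiteness (module Finiteness) uses that P is a
-- colimit of finitely many representables: merging labels of their vertices
-- along all morphisms of the diagram yields, through the universal property,
-- a labelling of the vertices of P by a finite set with decidable equality;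
-- and the image presheaf shows that every edge of P comes from a representable.

open import Defs
open import Data.Nat using (ℕ; zero; suc; _≤_; z≤n; s≤s)
open import Data.Fin as Fin using (Fin; zero; suc; _≟_; inject₁; fromℕ; punchIn)
import Data.Fin.Properties as FinP
open import Data.Bool using (Bool; true; false; T; _∨_)
open import Data.Bool.Properties using (T-irrelevant)
open import Data.Unit using (⊤; tt)
open import Data.Empty using (⊥; ⊥-elim; ⊥-elim-irr)
open import Data.Irrelevant using (Irrelevant; [_])
open import Data.Vec using (Vec; []; _∷_; lookup; map; tabulate; head; last)
open import Data.Vec.Properties
  using (map-cong; map-∘; map-id; lookup-map; lookup-allFin; lookup∘tabulate; tabulate∘lookup;
         tabulate-∘; tabulate-cong; ∷-injective; map-lookup-allFin)
open import Data.List as L using (List; concatMap)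
open import Data.List.Membership.Propositional using (_∈_; lose)
open import Data.List.Membership.Propositional.Properties
  using (∈-map⁺; ∈-concatMap⁺; ∈-allFin; ∈-deduplicate⁺; ∈-lookup)
open import Data.List.Membership.Propositional.Properties.WithK using (unique⇒irrelevant)
import Data.List.Membership.DecPropositional as DecMembership
open import Data.List.Relation.Unary.Any using (here; there; index)
open import Data.List.Relation.Unary.Any.Properties using (lookup-index)
import Data.List.Relation.Unary.Unique.DecPropositional.Properties as Unique
open import Data.Product using (Σ; _×_; _,_; proj₁; proj₂)
open import Data.Product.Properties using (≡-dec)
open import Function.Bundles using (_↔_; mk↔ₛ′)
open import Relation.Nullary using (Dec; yes; no; does)
open import Relation.Binary.Definitions using (DecidableEquality)
open import Relation.Binary.PropositionalEquality
open import Relation.Binary.PropositionalEquality.WithK using (≡-irrelevant)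

∘L-identityˡ : ∀ {m n} (f : Hom m n) → idL n ∘L f ≡ f
∘L-identityˡ (hom f _) = Hom-≡ (trans (map-cong lookup-allFin f) (map-id f))

-- The point a : 1 → n.  Note that f ∘L pt a reduces to pt (app f a).
pt : ∀ {n} → Fin n → Hom 1 n
pt a = hom (a ∷ []) λ { zero zero () }

pair : ∀ {n} (a b : Fin n) → a Fin.< b → Hom 2 n
pair a b a<b = hom (a ∷ b ∷ []) ordered
  where
  ordered : StrictlyIncreasing (a ∷ b ∷ [])
  ordered zero zero ()
  ordered zero (suc zero) _ = a<b
  ordered (suc zero) zero ()
  ordered (suc zero) (suc zero) (s≤s ())

Hom2-ext : ∀ {c} (f g : Hom 2 c) → f ∘L s 1 (suc zero) ≡ g ∘L s 1 (suc zero) →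
           f ∘L s 1 zero ≡ g ∘L s 1 zero → f ≡ g
Hom2-ext (hom (a ∷ b ∷ []) _) (hom (a′ ∷ b′ ∷ []) _) p q =
  Hom-≡ (cong₂ (λ x y → x ∷ y ∷ []) (cong (λ h → head (table h)) p) (cong (λ h → head (table h)) q))

e-suc : ∀ n (k : Fin n) → e (suc n) (suc k) ≡ s (suc n) zero ∘L e n k
e-suc n k = Hom-≡ (cong₂ _∷_ (sym (lookup∘tabulate (punchIn zero) (inject₁ k)))
                            (cong (_∷ []) (sym (lookup∘tabulate (punchIn zero) (suc k)))))

outer : ∀ n → Hom 2 (suc (suc n))
outer n = pair zero (fromℕ (suc n)) (s≤s z≤n)

Listed : Set → Set
Listed A = Σ (List A) λ xs → (x : A) → x ∈ xs

listed-Fin : ∀ n → Listed (Fin n)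
listed-Fin n = L.allFin n , ∈-allFin

listed-Σ : {A : Set} {B : A → Set} → Listed A → ((a : A) → Listed (B a)) → Listed (Σ A B)
listed-Σ {B = B} (as , as-complete) bs =
  concatMap fibre as ,
  λ (a , b) → ∈-concatMap⁺ fibre (lose (as-complete a) (∈-map⁺ (a ,_) (proj₂ (bs a) b)))
  where
  fibre : _ → List (Σ _ B)
  fibre a = L.map (a ,_) (proj₁ (bs a))

listed-⋃ : {A B : Set} → Listed A → (f : A → List B) → ((b : B) → Σ A λ a → b ∈ f a) → Listed B
listed-⋃ (as , as-complete) f cover =
  concatMap f as , λ b → ∈-concatMap⁺ f (lose (as-complete (proj₁ (cover b))) (proj₂ (cover b)))

-- A listed type with decidable equality is in bijection with some Fin k:
-- index into the list with duplicates removed.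
finite : {A : Set} → DecidableEquality A → Listed A → Σ ℕ λ k → A ↔ Fin k
finite {A} _≟A_ (xs , xs-complete) = L.length ys , mk↔ₛ′ position (L.lookup ys) position-lookup lookup-position
  where
  ys : List A
  ys = L.deduplicate _≟A_ xs
  member : ∀ a → a ∈ ys
  member a = ∈-deduplicate⁺ _≟A_ (xs-complete a)
  position : A → Fin (L.length ys)
  position a = index (member a)
  index-∈-lookup : ∀ (zs : List A) k → index (∈-lookup {xs = zs} k) ≡ k
  index-∈-lookup (z L.∷ zs) zero = refl
  index-∈-lookup (z L.∷ zs) (suc k) = cong suc (index-∈-lookup zs k)
  position-lookup : ∀ k → position (L.lookup ys k) ≡ k
  position-lookup k =
    trans (cong index (unique⇒irrelevant (Unique.deduplicate-! _≟A_ xs) (member (L.lookup ys k)) (∈-lookup k)))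
          (index-∈-lookup ys k)
  lookup-position : ∀ a → L.lookup ys (position a) ≡ a
  lookup-position a = sym (lookup-index (member a))

listed-Hom2 : ∀ n → Listed (Hom 2 n)
listed-Hom2 n = listed-⋃ (listed-Σ (listed-Fin n) (λ _ → listed-Fin n)) candidate cover
  where
  candidate : Fin n × Fin n → List (Hom 2 n)
  candidate (a , b) with a Fin.<? b
  ... | yes a<b = pair a b a<b L.∷ L.[]
  ... | no _ = L.[]
  cover : (h : Hom 2 n) → Σ (Fin n × Fin n) λ ab → h ∈ candidate ab
  cover (hom (a ∷ b ∷ []) ordered) = (a , b) , member
    where
    member : hom (a ∷ b ∷ []) ordered ∈ candidate (a , b)
    member with a Fin.<? b
    ... | yes _ = here refl
    ... | no a≮b = ⊥-elim-irr (a≮b (ordered zero (suc zero) (s≤s z≤n)))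

-- Finite categories whose non-identity arrows never compose

-- A Boolean b read as a hom-set with at most one element.
count : Bool → ℕ
count true = 1
count false = 0

count-irrelevant : ∀ b (x y : Fin (count b)) → x ≡ y
count-irrelevant true zero zero = refl

count→T : ∀ {b} → Fin (count b) → T b
count→T {true} _ = tt

T→count : ∀ {b} → T b → Fin (count b)
T→count {true} _ = zero

-- Given a relation `arrow` on Fin m with no composable pair of arrows, the
-- category `Shape` adds identities to it; all its composites are forced.
module SparseShape (m : ℕ) (arrow : Fin m → Fin m → Bool)
                   (no-composite : ∀ i j k → T (arrow i j) → T (arrow j k) → ⊥) where

  related : ∀ i j → Dec (i ≡ j) → Bool
  related i j d = does d ∨ arrow i j

  -- `related` is a preorder; transitivity holds because arrows never compose.
  related-refl : ∀ i (d : Dec (i ≡ i)) → T (related i i d)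
  related-refl i (yes _) = tt
  related-refl i (no i≢i) = ⊥-elim (i≢i refl)

  related-trans : ∀ i j k (dij : Dec (i ≡ j)) (djk : Dec (j ≡ k)) (dik : Dec (i ≡ k)) →
                  T (related i j dij) → T (related j k djk) → T (related i k dik)
  related-trans i .i k (yes refl) djk dik _ q with djk | dik
  ... | yes refl | yes _ = tt
  ... | yes refl | no i≢i = ⊥-elim (i≢i refl)
  ... | no i≢k | yes i≡k = ⊥-elim (i≢k i≡k)
  ... | no _ | no _ = q
  related-trans i j .j (no i≢j) (yes refl) dik p _ with dik
  ... | yes i≡j = ⊥-elim (i≢j i≡j)
  ... | no _ = p
  related-trans i j k (no _) (no _) dik p q = ⊥-elim (no-composite i j k p q)

  Shape : FinCat
  Shape = record
    { nOb = m
    ; nHom = λ i j → count (related i j (i ≟ j))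
    ; idJ = λ i → T→count (related-refl i (i ≟ i))
    ; compJ = λ {i} {j} {k} g f →
        T→count (related-trans i j k (i ≟ j) (j ≟ k) (i ≟ k) (count→T f) (count→T g))
    ; idJˡ = λ f → count-irrelevant _ _ _
    ; idJʳ = λ f → count-irrelevant _ _ _
    ; assocJ = λ h g f → count-irrelevant _ _ _
    }

  module SparseDiagram (obj : Fin m → ℕ) (arr : ∀ i j → T (arrow i j) → Hom (obj i) (obj j)) where

    morphism : ∀ i j (d : Dec (i ≡ j)) → T (related i j d) → Hom (obj i) (obj j)
    morphism i .i (yes refl) _ = idL (obj i)
    morphism i j (no _) p = arr i j p

    morphism-refl : ∀ i (d : Dec (i ≡ i)) p → morphism i i d p ≡ idL (obj i)
    morphism-refl i (yes refl) p = refl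
    morphism-refl i (no i≢i) p = ⊥-elim (i≢i refl)

    morphism-arrow : ∀ i j (d : Dec (i ≡ j)) p (q : T (arrow i j)) → morphism i j d p ≡ arr i j q
    morphism-arrow i .i (yes refl) p q = ⊥-elim (no-composite i i i q q)
    morphism-arrow i j (no _) p q = cong (arr i j) (T-irrelevant p q)

    morphism-∘ : ∀ i j k (dij : Dec (i ≡ j)) (djk : Dec (j ≡ k)) (dik : Dec (i ≡ k)) p q r →
                 morphism i k dik r ≡ morphism j k djk q ∘L morphism i j dij p
    morphism-∘ i .i k (yes refl) djk dik p q r with djk | dik
    ... | yes refl | yes refl = sym (∘L-identityˡ _)
    ... | yes refl | no i≢i = ⊥-elim (i≢i refl)
    ... | no i≢k | yes i≡k = ⊥-elim (i≢k i≡k)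
    ... | no _ | no _ = trans (cong (arr i k) (T-irrelevant r q)) (sym (∘L-identityʳ _))
    morphism-∘ i j .j (no i≢j) (yes refl) dik p q r with dik
    ... | yes i≡j = ⊥-elim (i≢j i≡j)
    ... | no _ = trans (cong (arr i j) (T-irrelevant r p)) (sym (∘L-identityˡ _))
    morphism-∘ i j k (no _) (no _) dik p q r = ⊥-elim (no-composite i j k p q)

    D : Diagram Shape
    D = record
      { ob = obj
      ; mor = λ {i} {j} f → morphism i j (i ≟ j) (count→T f)
      ; mor-id = λ i → morphism-refl i (i ≟ i) _
      ; mor-∘ = λ {i} {j} {k} g f → morphism-∘ i j k (i ≟ j) (j ≟ k) (i ≟ k) _ _ _
      }

    cocone-from-arrows : ∀ c (λc : ∀ i → Hom (obj i) c) →
                         (∀ i j (p : T (arrow i j)) → λc j ∘L arr i j p ≡ λc i) → IsCoconeL D c λc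
    cocone-from-arrows c λc compatible {i} {j} f = go (i ≟ j) (count→T f)
      where
      go : (d : Dec (i ≡ j)) (p : T (related i j d)) → λc j ∘L morphism i j d p ≡ λc i
      go (yes refl) p = ∘L-identityʳ _
      go (no _) p = compatible i j p

    arrows-from-cocone : ∀ c (λc : ∀ i → Hom (obj i) c) → IsCoconeL D c λc →
                         ∀ i j (p : T (arrow i j)) → λc j ∘L arr i j p ≡ λc i
    arrows-from-cocone c λc cocone i j p =
      trans (cong (λc j ∘L_) (sym (morphism-arrow i j (i ≟ j) _ p))) (cocone {i} {j} (T→count (as-related (i ≟ j))))
      where
      as-related : (d : Dec (i ≡ j)) → T (related i j d)
      as-related (yes _) = tt
      as-related (no _) = p

    cone-from-arrows : (P : Presheaf) (X : Set) (g : ∀ i → X → F₀ P (obj i)) →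
                       (∀ i j (p : T (arrow i j)) (x : X) → F₁ P (arr i j p) (g j x) ≡ g i x) →
                       ∀ {i j} (f : Fin (nHom Shape i j)) (x : X) → F₁ P (mor D f) (g j x) ≡ g i x
    cone-from-arrows P X g compatible {i} {j} f x = go (i ≟ j) (count→T f)
      where
      go : (d : Dec (i ≡ j)) (p : T (related i j d)) → F₁ P (morphism i j d p) (g j x) ≡ g i x
      go (yes refl) p = F-id P _
      go (no _) p = compatible i j p x

    module Preserved (P : Presheaf) (pfl : PreservesFiniteLimits P) (c : ℕ)
                     (λc : ∀ i → Hom (obj i) c) (colimit : IsColimitL D c λc) where

      glue : (g : ∀ i → F₀ P (obj i)) → (∀ i j p → F₁ P (arr i j p) (g j) ≡ g i) →
             Σ (F₀ P c) λ α → ∀ i → F₁ P (λc i) α ≡ g i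
      glue g compatible
        with pfl Shape D c λc colimit ⊤ (λ i _ → g i)
                 (cone-from-arrows P ⊤ (λ i _ → g i) (λ i j p _ → compatible i j p))
      ... | u , u-restricts , _ = u tt , λ i → u-restricts i tt

      jointly-injective : (α β : F₀ P c) → (∀ i → F₁ P (λc i) α ≡ F₁ P (λc i) β) → α ≡ β
      jointly-injective α β same
        with pfl Shape D c λc colimit ⊤ (λ i _ → F₁ P (λc i) α)
                 (cone-from-arrows P ⊤ (λ i _ → F₁ P (λc i) α) restrictions-compatible)
        where
        restrictions-compatible : ∀ i j (p : T (arrow i j)) (_ : ⊤) →
                                  F₁ P (arr i j p) (F₁ P (λc j) α) ≡ F₁ P (λc i) α
        restrictions-compatible i j p _ =
          trans (sym (F-∘ P (λc j) (arr i j p) α))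
                (cong (λ f → F₁ P f α) (arrows-from-cocone c λc (proj₁ colimit) i j p))
      ... | _ , _ , unique =
        trans (unique (λ _ → α) (λ i _ → refl) tt) (sym (unique (λ _ → β) (λ i _ → sym (same i)) tt))

-- Three colimits in 𝓛

module Empty where
  no-arrows : Fin 0 → Fin 0 → Bool
  no-arrows ()

  open SparseShape 0 no-arrows (λ ()) public
  open SparseDiagram (λ ()) (λ ()) public

  colimit : IsColimitL D 0 (λ ())
  colimit = cocone-from-arrows 0 (λ ()) (λ ()) ,
    λ c′ μ _ → hom [] (λ ()) , (λ ()) , λ u′ _ → Hom-≡ (empty (table u′))
    where
    empty : ∀ {A : Set} (v : Vec A 0) → v ≡ []
    empty [] = refl

-- Two edges glued along both endpoints have colimit 2: objects 0, 1 are the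
-- source and target vertices, objects 2, 3 the two edges.
module ParallelEdges where
  arrow : Fin 4 → Fin 4 → Bool
  arrow zero (suc (suc _)) = true
  arrow (suc zero) (suc (suc _)) = true
  arrow _ _ = false

  no-composite : ∀ i j k → T (arrow i j) → T (arrow j k) → ⊥
  no-composite zero (suc (suc j)) k _ ()
  no-composite (suc zero) (suc (suc j)) k _ ()

  obj : Fin 4 → ℕ
  obj zero = 1
  obj (suc zero) = 1
  obj (suc (suc _)) = 2

  arr : ∀ i j → T (arrow i j) → Hom (obj i) (obj j)
  arr zero (suc (suc _)) _ = s 1 (suc zero)
  arr (suc zero) (suc (suc _)) _ = s 1 zero

  open SparseShape 4 arrow no-composite public
  open SparseDiagram obj arr public

  edge₁ edge₂ : Fin 4
  edge₁ = suc (suc zero)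
  edge₂ = suc (suc (suc zero))

  λc : ∀ i → Hom (obj i) 2
  λc zero = s 1 (suc zero)
  λc (suc zero) = s 1 zero
  λc (suc (suc _)) = idL 2

  compatible : ∀ i j (p : T (arrow i j)) → λc j ∘L arr i j p ≡ λc i
  compatible zero (suc (suc _)) _ = ∘L-identityˡ _
  compatible (suc zero) (suc (suc _)) _ = ∘L-identityˡ _

  -- The mediating map is the leg at the first edge; it also fits the second
  -- edge because a morphism out of 2 is determined by its faces.
  colimit : IsColimitL D 2 λc
  colimit = cocone-from-arrows 2 λc compatible , universal
    where
    universal : (c′ : ℕ) (μ : ∀ i → Hom (obj i) c′) → IsCoconeL D c′ μ →
      Σ (Hom 2 c′) λ u → ((i : Fin 4) → u ∘L λc i ≡ μ i) ×
        ((u′ : Hom 2 c′) → ((i : Fin 4) → u′ ∘L λc i ≡ μ i) → u′ ≡ u)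
    universal c′ μ cocone = μ edge₁ , factors , λ u′ h → trans (sym (∘L-identityʳ u′)) (h edge₁)
      where
      μ-compatible = arrows-from-cocone c′ μ cocone
      factors : (i : Fin 4) → μ edge₁ ∘L λc i ≡ μ i
      factors zero = μ-compatible zero edge₁ tt
      factors (suc zero) = μ-compatible (suc zero) edge₁ tt
      factors (suc (suc zero)) = ∘L-identityʳ _
      factors (suc (suc (suc zero))) = trans (∘L-identityʳ _)
        (Hom2-ext (μ edge₁) (μ edge₂)
          (trans (μ-compatible zero edge₁ tt) (sym (μ-compatible zero edge₂ tt)))
          (trans (μ-compatible (suc zero) edge₁ tt) (sym (μ-compatible (suc zero) edge₂ tt))))

-- An edge (object 0) followed by n+1 vertices (object 1), glued along a
-- vertex (object 2), has colimit n+2: first edge e_0 and last face s_0.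
module EdgeThenPath (n : ℕ) where
  arrow : Fin 3 → Fin 3 → Bool
  arrow (suc (suc zero)) zero = true
  arrow (suc (suc zero)) (suc zero) = true
  arrow _ _ = false

  no-composite : ∀ i j k → T (arrow i j) → T (arrow j k) → ⊥
  no-composite (suc (suc zero)) zero k _ ()
  no-composite (suc (suc zero)) (suc zero) k _ ()

  obj : Fin 3 → ℕ
  obj zero = 2
  obj (suc zero) = suc n
  obj (suc (suc _)) = 1

  arr : ∀ i j → T (arrow i j) → Hom (obj i) (obj j)
  arr (suc (suc zero)) zero _ = s 1 zero
  arr (suc (suc zero)) (suc zero) _ = pt zero

  open SparseShape 3 arrow no-composite public
  open SparseDiagram obj arr public

  λc : ∀ i → Hom (obj i) (suc (suc n))
  λc zero = e (suc n) zero
  λc (suc zero) = s (suc n) zero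
  λc (suc (suc _)) = pt (suc zero)

  compatible : ∀ i j (p : T (arrow i j)) → λc j ∘L arr i j p ≡ λc i
  compatible (suc (suc zero)) zero _ = refl
  compatible (suc (suc zero)) (suc zero) _ = refl

  cons-increasing : ∀ {m c} (a b : Fin c) (t : Vec (Fin c) (suc m)) → a Fin.< b → b ≡ lookup t zero →
                    StrictlyIncreasing t → StrictlyIncreasing (a ∷ t)
  cons-increasing a b t a<b b≡t₀ t↑ zero (suc zero) _ = subst (a Fin.<_) b≡t₀ a<b
  cons-increasing a b t a<b b≡t₀ t↑ zero (suc (suc j)) _ =
    FinP.<-trans (subst (a Fin.<_) b≡t₀ a<b) (t↑ zero (suc j) (s≤s z≤n))
  cons-increasing a b t a<b b≡t₀ t↑ (suc i) (suc j) (s≤s i<j) = t↑ i j i<j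

  tail-of-cons : ∀ {A : Set} {m} (a : A) (t : Vec A m) → map (lookup (a ∷ t)) (tabulate suc) ≡ t
  tail-of-cons a t = trans (sym (tabulate-∘ (lookup (a ∷ t)) suc)) (tabulate∘lookup t)

  -- The mediating map of a cocone (μ₀, μ₁, μ₂) is the first vertex of μ₀
  -- followed by the table of μ₁.
  mediate : ∀ {c′} (μ₀ : Hom 2 c′) (μ₁ : Hom (suc n) c′) (μ₂ : Hom 1 c′) →
    μ₀ ∘L s 1 zero ≡ μ₂ → μ₁ ∘L pt zero ≡ μ₂ →
    Σ (Hom (suc (suc n)) c′) λ u →
      (u ∘L λc zero ≡ μ₀) × (u ∘L λc (suc zero) ≡ μ₁) × (u ∘L λc (suc (suc zero)) ≡ μ₂) ×
      ((u′ : Hom (suc (suc n)) c′) → u′ ∘L λc zero ≡ μ₀ → u′ ∘L λc (suc zero) ≡ μ₁ → u′ ≡ u)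
  mediate (hom (a ∷ b ∷ []) edge↑) (hom t t↑) μ₂ glued-edge glued-path =
    hom (a ∷ t) (cons-increasing a b t (edge↑ zero (suc zero) (s≤s z≤n)) b≡t₀ t↑) ,
    Hom-≡ (cong (λ x → a ∷ x ∷ []) (sym b≡t₀)) ,
    Hom-≡ (tail-of-cons a t) ,
    trans (Hom-≡ refl) glued-path ,
    unique
    where
    b≡t₀ : b ≡ lookup t zero
    b≡t₀ = trans (cong (λ h → head (table h)) glued-edge) (sym (cong (λ h → head (table h)) glued-path))
    unique : (u′ : Hom (suc (suc n)) _) → u′ ∘L λc zero ≡ hom (a ∷ b ∷ []) edge↑ →
             u′ ∘L λc (suc zero) ≡ hom t t↑ → u′ ≡ hom (a ∷ t) _
    unique (hom (x ∷ t′) _) on-edge on-path =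
      Hom-≡ (cong₂ _∷_ (cong (λ h → head (table h)) on-edge) (trans (sym (tail-of-cons x t′)) (cong table on-path)))

  colimit : IsColimitL D (suc (suc n)) λc
  colimit = cocone-from-arrows (suc (suc n)) λc compatible , λ c′ μ cocone →
    let glued = arrows-from-cocone c′ μ cocone (suc (suc zero))
        (u , on-edge , on-path , on-vertex , unique) =
          mediate (μ zero) (μ (suc zero)) (μ (suc (suc zero))) (glued zero tt) (glued (suc zero) tt)
    in u , (λ { zero → on-edge ; (suc zero) → on-path ; (suc (suc zero)) → on-vertex }) ,
       λ u′ h → unique u′ (h zero) (h (suc zero))

last-tabulate : ∀ {A : Set} k (f : Fin (suc k) → A) → last (tabulate f) ≡ f (fromℕ k)
last-tabulate zero f = refl
last-tabulate (suc k) f = last-tabulate k (λ i → f (suc i))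

module Edges (P : Presheaf) where

  -- The consecutive edges of an element of P(n+1) form a path: the target of
  -- edge j and the source of edge j+1 are both its vertex j+1.
  edgesOf-isPath : ∀ n α → IsPath P (edgesOf P n α)
  edgesOf-isPath n α i j j≡1+i = begin
    tgt P (lookup (edgesOf P n α) i)  ≡⟨ cong (tgt P) (lookup∘tabulate edge i) ⟩
    tgt P (edge i)                    ≡⟨ F-∘ P (e n i) (s 1 zero) α ⟨
    F₁ P (pt (suc i)) α               ≡⟨ cong (λ a → F₁ P (pt a) α) 1+i≡j ⟩
    F₁ P (pt (inject₁ j)) α           ≡⟨ F-∘ P (e n j) (s 1 (suc zero)) α ⟩
    src P (edge j)                    ≡⟨ cong (src P) (lookup∘tabulate edge j) ⟨
    src P (lookup (edgesOf P n α) j)  ∎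
    where
    open ≡-Reasoning
    edge : Fin n → Edge P
    edge k = F₁ P (e n k) α
    1+i≡j : suc i ≡ inject₁ j
    1+i≡j = FinP.toℕ-injective (sym (trans (FinP.toℕ-inject₁ j) j≡1+i))

  edgesOf-cons : ∀ n (α : F₀ P (suc (suc n))) →
    edgesOf P (suc n) α ≡ F₁ P (e (suc n) zero) α ∷ edgesOf P n (F₁ P (s (suc n) zero) α)
  edgesOf-cons n α = cong (F₁ P (e (suc n) zero) α ∷_) (tabulate-cong λ k →
    trans (cong (λ h → F₁ P h α) (e-suc n k)) (F-∘ P (s (suc n) zero) (e n k) α))

  outer-src : ∀ k (α : F₀ P (suc (suc k))) → src P (F₁ P (outer k) α) ≡ src P (head (edgesOf P (suc k) α))
  outer-src k α = trans (sym (F-∘ P (outer k) (s 1 (suc zero)) α)) (F-∘ P (e (suc k) zero) (s 1 (suc zero)) α)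

  outer-tgt : ∀ k (α : F₀ P (suc (suc k))) → tgt P (F₁ P (outer k) α) ≡ tgt P (last (edgesOf P (suc k) α))
  outer-tgt k α = begin
    tgt P (F₁ P (outer k) α)                   ≡⟨ F-∘ P (outer k) (s 1 zero) α ⟨
    F₁ P (pt (fromℕ (suc k))) α                ≡⟨ F-∘ P (e (suc k) (fromℕ k)) (s 1 zero) α ⟩
    tgt P (F₁ P (e (suc k) (fromℕ k)) α)       ≡⟨ cong (tgt P) (last-tabulate k (λ j → F₁ P (e (suc k) j) α)) ⟨
    tgt P (last (edgesOf P (suc k) α))         ∎
    where open ≡-Reasoning

-- Consequences of limit preservation

module LimitPreservation (P : Presheaf) (pfl : PreservesFiniteLimits P) where
  open Edges P

  -- P(0) is the limit of the empty diagram.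
  P0-singleton : Σ (F₀ P 0) λ x → (y : F₀ P 0) → y ≡ x
  P0-singleton
    with pfl Empty.Shape Empty.D 0 (λ ()) Empty.colimit ⊤ (λ ()) (Empty.cone-from-arrows P ⊤ (λ ()) (λ ()))
  ... | u , _ , unique = u tt , λ y → unique (λ _ → y) (λ ()) tt

  -- Two edges with the same endpoints glue to an element of P(2) restricting to both.
  edge-determined : (ε ε′ : Edge P) → src P ε′ ≡ src P ε → tgt P ε′ ≡ tgt P ε → ε′ ≡ ε
  edge-determined ε ε′ same-src same-tgt with glue family family-compatible
    where
    open ParallelEdges
    open Preserved P pfl 2 λc colimit
    family : ∀ i → F₀ P (obj i)
    family zero = src P ε
    family (suc zero) = tgt P ε
    family (suc (suc zero)) = ε
    family (suc (suc (suc zero))) = ε′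
    family-compatible : ∀ i j (p : T (arrow i j)) → F₁ P (arr i j p) (family j) ≡ family i
    family-compatible zero (suc (suc zero)) _ = refl
    family-compatible zero (suc (suc (suc zero))) _ = same-src
    family-compatible (suc zero) (suc (suc zero)) _ = refl
    family-compatible (suc zero) (suc (suc (suc zero))) _ = same-tgt
  ... | α , restricts = trans (sym (restricts ParallelEdges.edge₂)) (restricts ParallelEdges.edge₁)

  -- α ∈ P(n+2) is determined by its edges: by induction, its first edge and its
  -- last face determine it, as P(n+3) is the limit of the edge-then-path diagram.
  edgesOf-injective : ∀ n (α β : F₀ P (suc (suc n))) → edgesOf P (suc n) α ≡ edgesOf P (suc n) β → α ≡ β
  edgesOf-injective zero α β same = trans (sym (F-id P α)) (trans (proj₁ (∷-injective same)) (F-id P β))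
  edgesOf-injective (suc n) α β same =
    jointly-injective α β λ { zero → same-first ; (suc zero) → same-face ; (suc (suc zero)) → same-vertex }
    where
    open EdgeThenPath (suc n)
    open Preserved P pfl (suc (suc (suc n))) λc colimit
    split : (F₁ P (e (suc (suc n)) zero) α ≡ F₁ P (e (suc (suc n)) zero) β)
            × (edgesOf P (suc n) (F₁ P (s (suc (suc n)) zero) α) ≡ edgesOf P (suc n) (F₁ P (s (suc (suc n)) zero) β))
    split = ∷-injective (trans (sym (edgesOf-cons (suc n) α)) (trans same (edgesOf-cons (suc n) β)))
    same-first : F₁ P (e (suc (suc n)) zero) α ≡ F₁ P (e (suc (suc n)) zero) β
    same-first = proj₁ split
    same-face : F₁ P (s (suc (suc n)) zero) α ≡ F₁ P (s (suc (suc n)) zero) β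
    same-face = edgesOf-injective n _ _ (proj₂ split)
    same-vertex : F₁ P (pt (suc zero)) α ≡ F₁ P (pt (suc zero)) β
    same-vertex = trans (F-∘ P (s (suc (suc n)) zero) (pt zero) α)
                        (trans (cong (F₁ P (pt zero)) same-face) (sym (F-∘ P (s (suc (suc n)) zero) (pt zero) β)))

  -- Every path of length n+1 is the edges of some element of P(n+2): glue its
  -- first edge to an element realising the rest of the path.
  edgesOf-surjective : ∀ n (v : Vec (Edge P) (suc n)) → IsPath P v →
                       Σ (F₀ P (suc (suc n))) λ α → edgesOf P (suc n) α ≡ v
  edgesOf-surjective zero (ε ∷ []) _ = ε , cong (_∷ []) (F-id P ε)
  edgesOf-surjective (suc n) (ε ∷ w@(_ ∷ _)) path
    with edgesOf-surjective n w (λ i j j≡1+i → path (suc i) (suc j) (cong suc j≡1+i))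
  ... | β , β-realises with glue family family-compatible
    where
    open EdgeThenPath (suc n)
    open Preserved P pfl (suc (suc (suc n))) λc colimit
    family : ∀ i → F₀ P (obj i)
    family zero = ε
    family (suc zero) = β
    family (suc (suc zero)) = tgt P ε
    β-starts : F₁ P (pt zero) β ≡ tgt P ε
    β-starts = begin
      F₁ P (pt zero) β                  ≡⟨ F-∘ P (e (suc n) zero) (s 1 (suc zero)) β ⟩
      src P (head (edgesOf P (suc n) β)) ≡⟨ cong (λ w → src P (head w)) β-realises ⟩
      src P (head w)                    ≡⟨ path zero (suc zero) refl ⟨
      tgt P ε                           ∎
      where open ≡-Reasoning
    family-compatible : ∀ i j (p : T (arrow i j)) → F₁ P (arr i j p) (family j) ≡ family i
    family-compatible (suc (suc zero)) zero _ = refl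
    family-compatible (suc (suc zero)) (suc zero) _ = β-starts
  ... | α , restricts =
    α , trans (edgesOf-cons (suc n) α)
              (cong₂ _∷_ (restricts zero) (trans (cong (edgesOf P (suc n)) (restricts (suc zero))) β-realises))

  nerve : (n : ℕ) → 1 ≤ n →
          ((α : F₀ P (suc n)) → IsPath P (edgesOf P n α))
          × ((α β : F₀ P (suc n)) → edgesOf P n α ≡ edgesOf P n β → α ≡ β)
          × ((v : Vec (Edge P) n) → IsPath P v → Σ (F₀ P (suc n)) λ α → edgesOf P n α ≡ v)
  nerve (suc n) _ = edgesOf-isPath (suc n) , edgesOf-injective n , edgesOf-surjective n

  -- Part (2): the outer edge of the element realising a path is the unique
  -- edge from its start to its end.
  path-edge : (k : ℕ) (v : Vec (Edge P) (suc k)) → IsPath P v →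
              Σ (Edge P) λ ε → (src P ε ≡ src P (head v) × tgt P ε ≡ tgt P (last v)) ×
                ((ε′ : Edge P) → src P ε′ ≡ src P (head v) → tgt P ε′ ≡ tgt P (last v) → ε′ ≡ ε)
  path-edge k v path with edgesOf-surjective k v path
  ... | α , α-realises =
    F₁ P (outer k) α , (starts , ends) ,
    λ ε′ ε′-starts ε′-ends → edge-determined _ ε′ (trans ε′-starts (sym starts)) (trans ε′-ends (sym ends))
    where
    starts : src P (F₁ P (outer k) α) ≡ src P (head v)
    starts = trans (outer-src k α) (cong (λ w → src P (head w)) α-realises)
    ends : tgt P (F₁ P (outer k) α) ≡ tgt P (last v)
    ends = trans (outer-tgt k α) (cong (λ w → tgt P (last w)) α-realises)

-- Finiteness of a colimit of representables

map-lookup-map : ∀ {A B : Set} {m n} (g : A → B) (vs : Vec A m) (t : Vec (Fin m) n) →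
                 map g (map (lookup vs) t) ≡ map (lookup (map g vs)) t
map-lookup-map g vs t = trans (sym (map-∘ g (lookup vs) t)) (map-cong (λ k → sym (lookup-map k g vs)) t)

map-as-tabulate : ∀ {A : Set} {m n} (g : Fin m → A) (t : Vec (Fin m) n) → map g t ≡ tabulate (λ k → g (lookup t k))
map-as-tabulate g t = trans (cong (map g) (sym (tabulate∘lookup t))) (sym (tabulate-∘ g (lookup t)))

module Finiteness (P : Presheaf) {J : FinCat} (D : Diagram J)
                  (σ : ∀ i → NatTrans (よ (ob D i)) P) (colim : IsColimitPsh D P σ) where

  N : ℕ
  N = nOb J

  -- If a cocone τ over Q is carried back to σ by some π : Q ⇒ P, then the
  -- mediating morphism P ⇒ Q is a section of π, since π ∘ u and the identity
  -- both mediate σ.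
  section : (Q : Presheaf) (τ : ∀ i → NatTrans (よ (ob D i)) Q) → IsCoconePsh D Q τ →
            (π : NatTrans Q P) → (∀ i n h → η π n (η (τ i) n h) ≡ η (σ i) n h) →
            Σ (∀ n → F₀ P n → F₀ Q n) λ u → ∀ n x → η π n (u n x) ≡ x
  section Q τ τ-cocone π π-τ =
    η u , λ n x → trans (unique π∘u π∘u-mediates n x) (sym (unique identity (λ _ _ _ → refl) n x))
    where
    u : NatTrans P Q
    u = proj₁ (proj₂ colim Q τ τ-cocone)
    u-mediates : ∀ i n h → η u n (η (σ i) n h) ≡ η (τ i) n h
    u-mediates = proj₁ (proj₂ (proj₂ colim Q τ τ-cocone))
    u₀ : NatTrans P P
    u₀ = proj₁ (proj₂ colim P σ (proj₁ colim))
    unique : (v : NatTrans P P) → (∀ i n h → η v n (η (σ i) n h) ≡ η (σ i) n h) → ∀ n x → η v n x ≡ η u₀ n x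
    unique = proj₂ (proj₂ (proj₂ colim P σ (proj₁ colim)))
    π∘u : NatTrans P P
    π∘u = record { η = λ n x → η π n (η u n x)
                 ; natural = λ f x → trans (cong (η π _) (natural u f x)) (natural π f (η u _ x)) }
    π∘u-mediates : ∀ i n h → η π n (η u n (η (σ i) n h)) ≡ η (σ i) n h
    π∘u-mediates i n h = trans (cong (η π n) (u-mediates i n h)) (π-τ i n h)
    identity : NatTrans P P
    identity = record { η = λ n x → x ; natural = λ f x → refl }

  -- The image presheaf: every element of P comes from a representable.

  Covered : ∀ n → F₀ P n → Set
  Covered n x = Σ (Fin N) λ i → Σ (Hom n (ob D i)) λ h → η (σ i) n h ≡ x

  record Image (n : ℕ) : Set where
    constructor image
    field
      element : F₀ P n
      .covered : Covered n element

  image-≡ : ∀ {n} {x y : F₀ P n} .{cx : Covered n x} .{cy : Covered n y} → x ≡ y → image x cx ≡ image y cy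
  image-≡ refl = refl

  ImageP : Presheaf
  ImageP = record
    { F₀ = Image
    ; F₁ = λ { f (image x cx) → image (F₁ P f x) (restrict f cx) }
    ; F-id = λ { (image x _) → image-≡ (F-id P x) }
    ; F-∘ = λ { g f (image x _) → image-≡ (F-∘ P g f x) }
    }
    where
    restrict : ∀ {m n} (f : Hom m n) {x : F₀ P n} → Covered n x → Covered m (F₁ P f x)
    restrict f (i , h , refl) = i , h ∘L f , natural (σ i) f h

  covered-of : ∀ {n} (q : Image n) → Irrelevant (Covered n (Image.element q))
  covered-of (image x cx) = [ cx ]

  covered : ∀ n (x : F₀ P n) → Irrelevant (Covered n x)
  covered n x = subst (λ y → Irrelevant (Covered n y)) (back n x) (covered-of (u n x))
    where
    τ : ∀ i → NatTrans (よ (ob D i)) ImageP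
    τ i = record { η = λ n h → image (η (σ i) n h) (i , h , refl) ; natural = λ f h → image-≡ (natural (σ i) f h) }
    element : NatTrans ImageP P
    element = record { η = λ n → Image.element ; natural = λ f x → refl }
    u-back : Σ (∀ n → F₀ P n → Image n) λ u → ∀ n x → Image.element (u n x) ≡ x
    u-back = section ImageP τ (λ f n h → image-≡ (proj₁ colim f n h)) element (λ _ _ _ → refl)
    u : ∀ n → F₀ P n → Image n
    u = proj₁ u-back
    back : ∀ n x → Image.element (u n x) ≡ x
    back = proj₂ u-back

  -- Labels: the vertices of the representables, denoting vertices of P.

  Label : Set
  Label = Σ (Fin N) λ i → Fin (ob D i)

  _≟L_ : DecidableEquality Label
  _≟L_ = ≡-dec _≟_ _≟_

  listed-Label : Listed Label
  listed-Label = listed-Σ (listed-Fin N) (λ i → listed-Fin (ob D i))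

  ⟦_⟧ : Label → Vertex P
  ⟦ i , a ⟧ = η (σ i) 1 (pt a)

  -- The identifications made by the diagram: vertex a of D i and its image
  -- under D f : D i → D j denote the same vertex of P.
  Generator : Set
  Generator = Σ (Fin N) λ i → Σ (Fin N) λ j → Σ (Fin (nHom J i j)) λ _ → Fin (ob D i)

  lhs rhs : Generator → Label
  lhs (i , j , f , a) = i , a
  rhs (i , j , f , a) = j , app (mor D f) a

  generator-sound : ∀ g → ⟦ rhs g ⟧ ≡ ⟦ lhs g ⟧
  generator-sound (i , j , f , a) = proj₁ colim f 1 (pt a)

  listed-Generator : Listed Generator
  listed-Generator = listed-Σ (listed-Fin N) λ i → listed-Σ (listed-Fin N) λ j →
                     listed-Σ (listed-Fin (nHom J i j)) λ _ → listed-Fin (ob D i)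

  Labelling : Set
  Labelling = Label → Label

  Sound : Labelling → Set
  Sound ℓ = ∀ v → ⟦ ℓ v ⟧ ≡ ⟦ v ⟧

  Coarser : Labelling → Labelling → Set
  Coarser ℓ ℓ′ = ∀ v w → ℓ v ≡ ℓ w → ℓ′ v ≡ ℓ′ w

  relabel : Label → Label → Label → Label
  relabel old new v with v ≟L old
  ... | yes _ = new
  ... | no _ = v

  relabel-old : ∀ old new → relabel old new old ≡ new
  relabel-old old new with old ≟L old
  ... | yes _ = refl
  ... | no old≢old = ⊥-elim (old≢old refl)

  relabel-new : ∀ old new → relabel old new new ≡ new
  relabel-new old new with new ≟L old
  ... | yes _ = refl
  ... | no _ = refl

  relabel-sound : ∀ old new → ⟦ old ⟧ ≡ ⟦ new ⟧ → ∀ v → ⟦ relabel old new v ⟧ ≡ ⟦ v ⟧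
  relabel-sound old new same v with v ≟L old
  ... | yes refl = sym same
  ... | no _ = refl

  merge : Generator → Labelling → Labelling
  merge g ℓ v = relabel (ℓ (rhs g)) (ℓ (lhs g)) (ℓ v)

  merge-identifies : ∀ g ℓ → merge g ℓ (lhs g) ≡ merge g ℓ (rhs g)
  merge-identifies g ℓ = trans (relabel-new (ℓ (rhs g)) (ℓ (lhs g))) (sym (relabel-old (ℓ (rhs g)) (ℓ (lhs g))))

  merge-sound : ∀ g ℓ → Sound ℓ → Sound (merge g ℓ)
  merge-sound g ℓ ℓ-sound v =
    trans (relabel-sound (ℓ (rhs g)) (ℓ (lhs g)) same-class (ℓ v)) (ℓ-sound v)
    where
    same-class : ⟦ ℓ (rhs g) ⟧ ≡ ⟦ ℓ (lhs g) ⟧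
    same-class = trans (ℓ-sound (rhs g)) (trans (generator-sound g) (sym (ℓ-sound (lhs g))))

  mergeAll : List Generator → Labelling → Labelling
  mergeAll L.[] ℓ = ℓ
  mergeAll (g L.∷ gs) ℓ = mergeAll gs (merge g ℓ)

  mergeAll-sound : ∀ gs ℓ → Sound ℓ → Sound (mergeAll gs ℓ)
  mergeAll-sound L.[] ℓ ℓ-sound = ℓ-sound
  mergeAll-sound (g L.∷ gs) ℓ ℓ-sound = mergeAll-sound gs (merge g ℓ) (merge-sound g ℓ ℓ-sound)

  mergeAll-coarser : ∀ gs ℓ → Coarser ℓ (mergeAll gs ℓ)
  mergeAll-coarser L.[] ℓ v w same = same
  mergeAll-coarser (g L.∷ gs) ℓ v w same =
    mergeAll-coarser gs (merge g ℓ) v w (cong (relabel (ℓ (rhs g)) (ℓ (lhs g))) same)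

  mergeAll-identifies : ∀ gs ℓ g → g ∈ gs → mergeAll gs ℓ (lhs g) ≡ mergeAll gs ℓ (rhs g)
  mergeAll-identifies (g L.∷ gs) ℓ .g (here refl) = mergeAll-coarser gs (merge g ℓ) _ _ (merge-identifies g ℓ)
  mergeAll-identifies (g′ L.∷ gs) ℓ g (there g∈gs) = mergeAll-identifies gs (merge g′ ℓ) g g∈gs

  canonical : Labelling
  canonical = mergeAll (proj₁ listed-Generator) (λ v → v)

  canonical-sound : Sound canonical
  canonical-sound = mergeAll-sound (proj₁ listed-Generator) (λ v → v) (λ _ → refl)

  canonical-identifies : ∀ g → canonical (lhs g) ≡ canonical (rhs g)
  canonical-identifies g = mergeAll-identifies (proj₁ listed-Generator) (λ v → v) g (proj₂ listed-Generator g)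

  vertices : ∀ {n} → F₀ P n → Vec (Vertex P) n
  vertices x = tabulate λ k → F₁ P (pt k) x

  vertices-restrict : ∀ {m n} (f : Hom m n) (x : F₀ P n) →
                      vertices (F₁ P f x) ≡ map (lookup (vertices x)) (table f)
  vertices-restrict f x = begin
    tabulate (λ k → F₁ P (pt k) (F₁ P f x))          ≡⟨ tabulate-cong (λ k → F-∘ P f (pt k) x) ⟨
    tabulate (λ k → F₁ P (pt (app f k)) x)           ≡⟨ tabulate-cong (λ k → lookup∘tabulate _ (app f k)) ⟨
    tabulate (λ k → lookup (vertices x) (app f k))   ≡⟨ map-as-tabulate (lookup (vertices x)) (table f) ⟨
    map (lookup (vertices x)) (table f)              ∎
    where open ≡-Reasoning

  record Labelled (n : ℕ) : Set where
    constructor labelled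
    field
      element : F₀ P n
      labels : Vec Label n
      denotes : map ⟦_⟧ labels ≡ vertices element

  labelled-≡ : ∀ {n} {x y : F₀ P n} {vs ws : Vec Label n} {dx dy} →
               x ≡ y → vs ≡ ws → labelled x vs dx ≡ labelled y ws dy
  labelled-≡ {dx = dx} {dy} refl refl = cong (labelled _ _) (≡-irrelevant dx dy)

  restrict-denotes : ∀ {m n} (f : Hom m n) (x : F₀ P n) (vs : Vec Label n) → map ⟦_⟧ vs ≡ vertices x →
                     map ⟦_⟧ (map (lookup vs) (table f)) ≡ vertices (F₁ P f x)
  restrict-denotes f x vs vs-denote =
    trans (map-lookup-map ⟦_⟧ vs (table f))
          (trans (cong (λ ws → map (lookup ws) (table f)) vs-denote) (sym (vertices-restrict f x)))

  LabelledP : Presheaf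
  LabelledP = record
    { F₀ = Labelled
    ; F₁ = λ { f (labelled x vs d) → labelled (F₁ P f x) (map (lookup vs) (table f)) (restrict-denotes f x vs d) }
    ; F-id = λ { (labelled x vs _) → labelled-≡ (F-id P x) (map-lookup-allFin vs) }
    ; F-∘ = λ { g f (labelled x vs _) → labelled-≡ (F-∘ P g f x) (map-lookup-map (lookup vs) (table g) (table f)) }
    }

  canonically-labelled : ∀ i → NatTrans (よ (ob D i)) LabelledP
  canonically-labelled i = record
    { η = λ n h → labelled (η (σ i) n h) (map label (table h)) (denotes h)
    ; natural = λ f h → labelled-≡ (natural (σ i) f h) (map-lookup-map label (table h) (table f))
    }
    where
    label : Fin (ob D i) → Label
    label a = canonical (i , a)
    denotes : ∀ {n} (h : Hom n (ob D i)) → map ⟦_⟧ (map label (table h)) ≡ vertices (η (σ i) n h)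
    denotes h = begin
      map ⟦_⟧ (map label (table h))                      ≡⟨ map-∘ ⟦_⟧ label (table h) ⟨
      map (λ a → ⟦ label a ⟧) (table h)                  ≡⟨ map-cong (λ a → canonical-sound (i , a)) (table h) ⟩
      map (λ a → ⟦ i , a ⟧) (table h)                    ≡⟨ map-as-tabulate (λ a → ⟦ i , a ⟧) (table h) ⟩
      tabulate (λ k → ⟦ i , lookup (table h) k ⟧)        ≡⟨ tabulate-cong (λ k → natural (σ i) (pt k) h) ⟩
      vertices (η (σ i) _ h)                             ∎
      where open ≡-Reasoning

  canonically-labelled-cocone : IsCoconePsh D LabelledP canonically-labelled
  canonically-labelled-cocone {i} {j} f n h = labelled-≡ (proj₁ colim f n h) (begin
    map (λ b → canonical (j , b)) (map (app (mor D f)) (table h))  ≡⟨ map-∘ _ (app (mor D f)) (table h) ⟨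
    map (λ a → canonical (j , app (mor D f) a)) (table h)         ≡⟨ map-cong (λ a → canonical-identifies (i , j , f , a)) (table h) ⟨
    map (λ a → canonical (i , a)) (table h)                       ∎)
    where open ≡-Reasoning

  -- Through the universal property, every element of P is labelled.
  labelling : Σ (∀ n → F₀ P n → Labelled n) λ u → ∀ n x → Labelled.element (u n x) ≡ x
  labelling = section LabelledP canonically-labelled canonically-labelled-cocone
                (record { η = λ n → Labelled.element ; natural = λ f → λ { (labelled _ _ _) → refl } })
                (λ _ _ _ → refl)

  vertex-label : Vertex P → Label
  vertex-label x = head (Labelled.labels (proj₁ labelling 1 x))

  vertex-label-denotes : ∀ x → ⟦ vertex-label x ⟧ ≡ x
  vertex-label-denotes x = trans (head-denotes (proj₁ labelling 1 x)) (proj₂ labelling 1 x)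
    where
    head-denotes : (q : Labelled 1) → ⟦ head (Labelled.labels q) ⟧ ≡ Labelled.element q
    head-denotes (labelled y (v ∷ []) v-denotes) = trans (proj₁ (∷-injective v-denotes)) (F-id P y)

  _≟V_ : DecidableEquality (Vertex P)
  x ≟V y with vertex-label x ≟L vertex-label y
  ... | yes same = yes (trans (sym (vertex-label-denotes x)) (trans (cong ⟦_⟧ same) (vertex-label-denotes y)))
  ... | no differ = no (λ x≡y → differ (cong vertex-label x≡y))

  vertices-finite : Σ ℕ λ k → Vertex P ↔ Fin k
  vertices-finite = finite _≟V_ (L.map ⟦_⟧ labels , λ x →
    subst (_∈ L.map ⟦_⟧ labels) (vertex-label-denotes x) (∈-map⁺ ⟦_⟧ (proj₂ listed-Label (vertex-label x))))
    where
    labels : List Label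
    labels = proj₁ listed-Label

  -- Edges: given that an edge is determined by its endpoints, they have
  -- decidable equality, and the covering of P(2) by the representables is
  -- decidable, so the edges of the representables enumerate them.
  edges-finite : ((ε ε′ : Edge P) → src P ε′ ≡ src P ε → tgt P ε′ ≡ tgt P ε → ε′ ≡ ε) →
                 Σ ℕ λ k → Edge P ↔ Fin k
  edges-finite edge-determined = finite _≟E_ (edges , listed)
    where
    _≟E_ : DecidableEquality (Edge P)
    ε ≟E ε′ with src P ε ≟V src P ε′ | tgt P ε ≟V tgt P ε′
    ... | yes same-src | yes same-tgt = yes (sym (edge-determined ε ε′ (sym same-src) (sym same-tgt)))
    ... | no differ | _ = no (λ ε≡ε′ → differ (cong (src P) ε≡ε′))
    ... | yes _ | no differ = no (λ ε≡ε′ → differ (cong (tgt P) ε≡ε′))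
    representable-edges : Listed (Σ (Fin N) λ i → Hom 2 (ob D i))
    representable-edges = listed-Σ (listed-Fin N) (λ i → listed-Hom2 (ob D i))
    edge : Σ (Fin N) (λ i → Hom 2 (ob D i)) → Edge P
    edge (i , h) = η (σ i) 2 h
    edges : List (Edge P)
    edges = L.map edge (proj₁ representable-edges)
    covered-listed : ∀ ε → Covered 2 ε → ε ∈ edges
    covered-listed ε (i , h , refl) = ∈-map⁺ edge (proj₂ representable-edges (i , h))
    open DecMembership _≟E_ using (_∈?_)
    listed : ∀ ε → ε ∈ edges
    listed ε with ε ∈? edges | covered 2 ε
    ... | yes ε∈edges | _ = ε∈edges
    ... | no ε∉edges | [ c ] = ⊥-elim-irr (ε∉edges (covered-listed ε c))

proposition10 : (P : Presheaf) → FiniteColimitOfRepresentables P → PreservesFiniteLimits P →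
  ((Σ ℕ λ k → Vertex P ↔ Fin k) × (Σ ℕ λ k → Edge P ↔ Fin k))
  × ((k : ℕ) (v : Vec (Edge P) (suc k)) → IsPath P v →
      Σ (Edge P) λ ε → (src P ε ≡ src P (head v) × tgt P ε ≡ tgt P (last v)) ×
        ((ε′ : Edge P) → src P ε′ ≡ src P (head v) → tgt P ε′ ≡ tgt P (last v) → ε′ ≡ ε))
  × (((n : ℕ) → 1 ≤ n →
        ((α : F₀ P (suc n)) → IsPath P (edgesOf P n α))
        × ((α β : F₀ P (suc n)) → edgesOf P n α ≡ edgesOf P n β → α ≡ β)
        × ((v : Vec (Edge P) n) → IsPath P v → Σ (F₀ P (suc n)) λ α → edgesOf P n α ≡ v))
     × (Σ (F₀ P 0) λ x → (y : F₀ P 0) → y ≡ x))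
proposition10 P (J , D , σ , colim) pfl =
  (vertices-finite , edges-finite edge-determined) , path-edge , (nerve , P0-singleton)
  where
  open LimitPreservation P pfl
  open Finiteness P D σ colim
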